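{- Let $G$ be a cycle of length $2\ell$ whose edges are each colored red, blue or yellow, numbered consecutively $0,\dots,2\ell-1$, let $M_0,M_1$ be the perfect matchings of even-numbered and odd-numbered edges, let $r_0=|M_0\cap R|$, $b_0=|M_0\cap B|$, let $k_R,k_B$ be integers and $q=(k_R-r_0,k_B-b_0)$. Let $d$ be the imbalance curve of $G$ and $d^\infty$ its periodic extension. If $u,v$ are integers with $0<v<\ell$, $v<u<v+\ell$ and $d^\infty(u)=d(v)+q$, then the path $P$ consisting of the edges $2v,2v+1,\dots,2u-1$ (numbers taken modulo $2\ell$) is good.
   Context: $R$, $B$ are the sets of red and blue edges. For a path $P$ of $G$ (or $P=G$) with edge set identified with $P$, let $P_0=P\cap M_0$ and $P_1=P\cap M_1$; the imbalance of $P$ is $\delta(P)=(|P_1\cap R|-|P_0\cap R|,\ |P_1\cap B|-|P_0\cap B|)\in\mathbb R^2$. The imbalance curve $d:[0,\ell]\to\mathbb R^2$ is the piecewise-linear map with $d(t)=\delta(\{0,\dots,2t-1\})$ for $t\in\{0,1,\dots,\ell\}$ (so $d(0)=(0,0)$), linearly interpolated between consecutive integers. Its periodic extension is $d^\infty(t)=k\,(d(\ell)-d(0))+d(r)$ for $t=k\ell+r$, $k\in\mathbb Z$, $0\le r<\ell$. A nontrivial even path $P$ of $G$ is good if it starts at an even edge, i.e., its edges are $2v,\dots,2u-1$ (modulo $2\ell$) for some integers $v<u<v+\ell$, and $\delta(P)=q$. -}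

module Defs where

open import Data.Nat as ℕ using (ℕ; zero; suc; NonZero)
open import Data.Nat.Properties using (m*n≢0)
open import Data.Nat.DivMod using (_mod_)
open import Data.Fin using (Fin; toℕ)
open import Data.Integer as ℤ using (ℤ; +_; _+_; _-_; _*_; ∣_∣; _/ℕ_; _%ℕ_; _<_; 0ℤ; 1ℤ; -1ℤ)
open import Data.Product using (_×_; _,_; ∃-syntax)
open import Data.List using (List; []; _∷_; map; foldr)
open import Relation.Binary.PropositionalEquality using (_≡_)

data Colour : Set where
  red blue yellow : Colour

ℤ² : Set
ℤ² = ℤ × ℤ

0² : ℤ²
0² = (0ℤ , 0ℤ)

_+²_ : ℤ² → ℤ² → ℤ²
(a , b) +² (c , d) = (a + c , b + d)

_-²_ : ℤ² → ℤ² → ℤ²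
(a , b) -² (c , d) = (a - c , b - d)

_·²_ : ℤ → ℤ² → ℤ²
k ·² (a , b) = (k * a , k * b)

nz2ℓ : ∀ {ℓ} .{{nz : NonZero ℓ}} → NonZero (2 ℕ.* ℓ)
nz2ℓ {ℓ} {{nz}} = m*n≢0 2 ℓ {{_}} {{nz}}

-- The cycle G has 2ℓ edges, numbered 0,…,2ℓ-1 (consecutive edges share a
-- vertex, edge 2ℓ-1 is adjacent to edge 0).  M₀ = even-numbered edges, M₁ = odd-numbered.

edge : (ℓ : ℕ) .{{_ : NonZero ℓ}} → ℤ → Fin (2 ℕ.* ℓ)
edge ℓ i = _mod_ (_%ℕ_ i (2 ℕ.* ℓ) {{nz2ℓ}}) (2 ℕ.* ℓ) {{nz2ℓ}}

data Parity : Set where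
  even odd : Parity

parity : ℕ → Parity
parity zero = even
parity (suc zero) = odd
parity (suc (suc n)) = parity n

sign : Parity → ℤ
sign even = -1ℤ
sign odd  = 1ℤ

contrib : ℤ → Colour → ℤ²
contrib s red    = (s , 0ℤ)
contrib s blue   = (0ℤ , s)
contrib s yellow = 0²

-- imbalance δ(P) = (|P₁∩R| - |P₀∩R|, |P₁∩B| - |P₀∩B|) of a path, given
-- as the list of its (distinct) edges
δ : (ℓ : ℕ) → (Fin (2 ℕ.* ℓ) → Colour) → List (Fin (2 ℕ.* ℓ)) → ℤ²
δ ℓ col = foldr (λ e acc → contrib (sign (parity (toℕ e))) (col e) +² acc) 0²

range : ℤ → ℕ → List ℤ
range a zero    = []
range a (suc n) = a ∷ range (a + 1ℤ) n

-- the path with edges a, a+1, …, b-1 (numbers modulo 2ℓ), for a ≤ b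
pathE : (ℓ : ℕ) .{{_ : NonZero ℓ}} → ℤ → ℤ → List (Fin (2 ℕ.* ℓ))
pathE ℓ a b = map (edge ℓ) (range a ∣ b - a ∣)

-- imbalance curve at integer points t ∈ {0,…,ℓ}: d(t) = δ({0,…,2t-1})
d : (ℓ : ℕ) .{{_ : NonZero ℓ}} → (Fin (2 ℕ.* ℓ) → Colour) → ℤ → ℤ²
d ℓ col t = δ ℓ col (pathE ℓ 0ℤ (+ 2 * t))

d∞ : (ℓ : ℕ) .{{_ : NonZero ℓ}} → (Fin (2 ℕ.* ℓ) → Colour) → ℤ → ℤ²
d∞ ℓ col t = ((t /ℕ ℓ) ·² (d ℓ col (+ ℓ) -² d ℓ col 0ℤ)) +² d ℓ col (+ (t %ℕ ℓ))

countM₀ : (ℓ : ℕ) .{{_ : NonZero ℓ}} → (Fin (2 ℕ.* ℓ) → Colour) → Colour → ℤ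
countM₀ ℓ col c = foldr (λ e acc → isM₀ e (col e) + acc) 0ℤ (pathE ℓ 0ℤ (+ (2 ℕ.* ℓ)))
  where
  same : Colour → Colour → ℤ
  same red red = 1ℤ
  same blue blue = 1ℤ
  same yellow yellow = 1ℤ
  same _ _ = 0ℤ
  isM₀ : Fin (2 ℕ.* ℓ) → Colour → ℤ
  isM₀ e c' with parity (toℕ e)
  ... | even = same c c'
  ... | odd  = 0ℤ

qVec : (ℓ : ℕ) .{{_ : NonZero ℓ}} → (Fin (2 ℕ.* ℓ) → Colour) → ℤ → ℤ → ℤ²
qVec ℓ col kR kB = (kR - countM₀ ℓ col red , kB - countM₀ ℓ col blue)

Good : (ℓ : ℕ) .{{_ : NonZero ℓ}} → (Fin (2 ℕ.* ℓ) → Colour) → ℤ² →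
       List (Fin (2 ℕ.* ℓ)) → Set
Good ℓ col q P = ∃[ v ] ∃[ u ] (v < u × u < v + + ℓ
                 × P ≡ pathE ℓ (+ 2 * v) (+ 2 * u) × δ ℓ col P ≡ q)

-- The value of the imbalance curve at an integer t, for d as well as for its
-- periodic extension d∞, is the imbalance of the walk along the edges
-- 0, 1, …, 2t-1 taken modulo 2ℓ: for d∞ this is because the edge colouring
-- and parity are 2ℓ-periodic, so each full turn around the cycle adds
-- d(ℓ) - d(0) = δ(G).  Imbalance is additive along walks, hence for
-- 0 ≤ v ≤ u we get d∞(u) = d(v) + δ(P) with P the edges 2v, …, 2u-1, and the
-- hypothesis d∞(u) = d(v) + q yields δ(P) = q after cancelling d(v).
module Submission where

open import Defs
open import Data.Nat using (ℕ; NonZero)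
open import Data.Fin using (Fin; toℕ)
open import Data.Integer using (ℤ; +_; _+_; _*_; _<_; 0ℤ)
open import Relation.Binary.PropositionalEquality using (_≡_)

open import Data.Nat as ℕ using (zero; suc; _≤_)
import Data.Nat.Properties as ℕ
open import Data.Nat.DivMod using (_/_; _%_; _mod_; m≡m%n+[m/n]*n; [m+n]%n≡m%n)
open import Data.Nat.Solver using (module +-*-Solver)
import Data.Integer as ℤ
import Data.Integer.Properties as ℤ
open import Algebra.Properties.AbelianGroup ℤ.+-0-abelianGroup using () renaming (∙-cancelˡ to +-cancelˡ)
open import Data.Product using (_,_; proj₁; proj₂)
open import Data.List using (map)
open import Relation.Binary.PropositionalEquality using (refl; sym; trans; cong; cong₂)
open Relation.Binary.PropositionalEquality.≡-Reasoning

+²-assoc : ∀ x y z → (x +² y) +² z ≡ x +² (y +² z)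
+²-assoc (a , b) (c , e) (f , g) = cong₂ _,_ (ℤ.+-assoc a c f) (ℤ.+-assoc b e g)

+²-identityˡ : ∀ x → 0² +² x ≡ x
+²-identityˡ (a , b) = cong₂ _,_ (ℤ.+-identityˡ a) (ℤ.+-identityˡ b)

-²-identityʳ : ∀ x → x -² 0² ≡ x
-²-identityʳ (a , b) = cong₂ _,_ (ℤ.+-identityʳ a) (ℤ.+-identityʳ b)

suc-·² : ∀ k x → (+ suc k) ·² x ≡ x +² ((+ k) ·² x)
suc-·² k (a , b) = cong₂ _,_ (ℤ.suc-* (+ k) a) (ℤ.suc-* (+ k) b)

+²-cancelˡ : ∀ a x y → a +² x ≡ a +² y → x ≡ y
+²-cancelˡ (a , b) (x , x′) (y , y′) eq =
  cong₂ _,_ (+-cancelˡ a x y (cong proj₁ eq)) (+-cancelˡ b x′ y′ (cong proj₂ eq))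

module Walk (ℓ : ℕ) .{{_ : NonZero ℓ}} (col : Fin (2 ℕ.* ℓ) → Colour) where

  N : ℕ
  N = 2 ℕ.* ℓ

  walk : ℕ → ℕ → ℤ²
  walk a n = δ ℓ col (map (edge ℓ) (range (+ a) n))

  imbalance : Fin N → ℤ²
  imbalance e = contrib (sign (parity (toℕ e))) (col e)

  walk-suc : ∀ a n → walk a (suc n) ≡ imbalance (edge ℓ (+ a)) +² walk (suc a) n
  walk-suc a n = cong (λ b → imbalance (edge ℓ (+ a)) +² walk b n) (ℕ.+-comm a 1)

  walk-++ : ∀ a m n → walk a (m ℕ.+ n) ≡ walk a m +² walk (a ℕ.+ m) n
  walk-++ a zero    n rewrite ℕ.+-identityʳ a = sym (+²-identityˡ (walk a n))
  walk-++ a (suc m) n = begin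
    walk a (suc m ℕ.+ n)             ≡⟨ walk-suc a (m ℕ.+ n) ⟩
    x +² walk (suc a) (m ℕ.+ n)      ≡⟨ cong (x +²_) (walk-++ (suc a) m n) ⟩
    x +² (y +² z)                    ≡⟨ sym (+²-assoc x y z) ⟩
    (x +² y) +² z                    ≡⟨ cong₂ _+²_ (sym (walk-suc a m))
                                                  (cong (λ b → walk b n) (sym (ℕ.+-suc a m))) ⟩
    walk a (suc m) +² walk (a ℕ.+ suc m) n ∎
    where
    x = imbalance (edge ℓ (+ a))
    y = walk (suc a) m
    z = walk (suc a ℕ.+ m) n

  edge-periodic : ∀ a → edge ℓ (+ (a ℕ.+ N)) ≡ edge ℓ (+ a)
  edge-periodic a = cong (λ m → _mod_ m N {{nz2ℓ}}) ([m+n]%n≡m%n a N {{nz2ℓ}})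

  walk-periodic : ∀ a n → walk (a ℕ.+ N) n ≡ walk a n
  walk-periodic a zero    = refl
  walk-periodic a (suc n) = begin
    walk (a ℕ.+ N) (suc n)                                   ≡⟨ walk-suc (a ℕ.+ N) n ⟩
    imbalance (edge ℓ (+ (a ℕ.+ N))) +² walk (suc a ℕ.+ N) n ≡⟨ cong₂ _+²_ (cong imbalance (edge-periodic a))
                                                                            (walk-periodic (suc a) n) ⟩
    imbalance (edge ℓ (+ a)) +² walk (suc a) n               ≡⟨ sym (walk-suc a n) ⟩
    walk a (suc n)                                           ∎

  walk-cycles : ∀ a k n → walk a (k ℕ.* N ℕ.+ n) ≡ ((+ k) ·² walk a N) +² walk a n
  walk-cycles a zero    n = sym (+²-identityˡ (walk a n))
  walk-cycles a (suc k) n = begin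
    walk a (N ℕ.+ k ℕ.* N ℕ.+ n)        ≡⟨ cong (walk a) (ℕ.+-assoc N (k ℕ.* N) n) ⟩
    walk a (N ℕ.+ (k ℕ.* N ℕ.+ n))      ≡⟨ walk-++ a N (k ℕ.* N ℕ.+ n) ⟩
    T +² walk (a ℕ.+ N) (k ℕ.* N ℕ.+ n) ≡⟨ cong (T +²_) (walk-periodic a (k ℕ.* N ℕ.+ n)) ⟩
    T +² walk a (k ℕ.* N ℕ.+ n)         ≡⟨ cong (T +²_) (walk-cycles a k n) ⟩
    T +² (((+ k) ·² T) +² walk a n)     ≡⟨ sym (+²-assoc T ((+ k) ·² T) (walk a n)) ⟩
    (T +² ((+ k) ·² T)) +² walk a n     ≡⟨ cong (_+² walk a n) (sym (suc-·² k T)) ⟩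
    ((+ suc k) ·² T) +² walk a n        ∎
    where
    T = walk a N

  δ-pathE-even : ∀ {v u} → v ≤ u →
    δ ℓ col (pathE ℓ (+ 2 * + v) (+ 2 * + u)) ≡ walk (2 ℕ.* v) (2 ℕ.* u ℕ.∸ 2 ℕ.* v)
  δ-pathE-even {v} {u} v≤u
    rewrite sym (ℤ.pos-* 2 v) | sym (ℤ.pos-* 2 u)
          | ℤ.m-n≡m⊖n (2 ℕ.* u) (2 ℕ.* v) | ℤ.⊖-≥ (ℕ.*-monoʳ-≤ 2 v≤u) = refl

  d≡walk : ∀ t → d ℓ col (+ t) ≡ walk 0 (2 ℕ.* t)
  d≡walk t = δ-pathE-even {0} {t} ℕ.z≤n

  d∞≡walk : ∀ t → d∞ ℓ col (+ t) ≡ walk 0 (2 ℕ.* t)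
  d∞≡walk t = begin
    d∞ ℓ col (+ t)                                      ≡⟨⟩
    ((+ k) ·² (d ℓ col (+ ℓ) -² 0²)) +² d ℓ col (+ r)   ≡⟨ cong₂ (λ x y → ((+ k) ·² x) +² y)
                                                            (trans (-²-identityʳ (d ℓ col (+ ℓ))) (d≡walk ℓ))
                                                            (d≡walk r) ⟩
    ((+ k) ·² walk 0 N) +² walk 0 (2 ℕ.* r)             ≡⟨ sym (walk-cycles 0 k (2 ℕ.* r)) ⟩
    walk 0 (k ℕ.* N ℕ.+ 2 ℕ.* r)                        ≡⟨ cong (walk 0) (sym doubled-division) ⟩
    walk 0 (2 ℕ.* t)                                    ∎
    where
    k r : ℕ
    k = t / ℓ
    r = t % ℓ
    open +-*-Solver
    doubled-division : 2 ℕ.* t ≡ k ℕ.* N ℕ.+ 2 ℕ.* r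
    doubled-division = trans (cong (2 ℕ.*_) (m≡m%n+[m/n]*n t ℓ))
      (solve 3 (λ k ℓ r → con 2 :* (r :+ k :* ℓ) := k :* (con 2 :* ℓ) :+ con 2 :* r) refl k ℓ r)

  d∞≡d+δ : ∀ {v u} → v ≤ u →
    d∞ ℓ col (+ u) ≡ d ℓ col (+ v) +² δ ℓ col (pathE ℓ (+ 2 * + v) (+ 2 * + u))
  d∞≡d+δ {v} {u} v≤u = begin
    d∞ ℓ col (+ u)                   ≡⟨ d∞≡walk u ⟩
    walk 0 (2 ℕ.* u)                 ≡⟨ cong (walk 0) (sym (ℕ.m+[n∸m]≡n 2v≤2u)) ⟩
    walk 0 (2 ℕ.* v ℕ.+ m)           ≡⟨ walk-++ 0 (2 ℕ.* v) m ⟩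
    walk 0 (2 ℕ.* v) +² walk (2 ℕ.* v) m
                                     ≡⟨ cong₂ _+²_ (sym (d≡walk v)) (sym (δ-pathE-even v≤u)) ⟩
    d ℓ col (+ v) +² δ ℓ col (pathE ℓ (+ 2 * + v) (+ 2 * + u)) ∎
    where
    2v≤2u : 2 ℕ.* v ≤ 2 ℕ.* u
    2v≤2u = ℕ.*-monoʳ-≤ 2 v≤u
    m : ℕ
    m = 2 ℕ.* u ℕ.∸ 2 ℕ.* v

lemma2p9 : (ℓ : ℕ) .{{_ : NonZero ℓ}} (col : Fin (2 Data.Nat.* ℓ) → Colour)
    (kR kB u v : ℤ) →
    0ℤ < v → v < + ℓ → v < u → u < v + + ℓ →
    d∞ ℓ col u ≡ d ℓ col v +² qVec ℓ col kR kB →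
    Good ℓ col (qVec ℓ col kR kB) (pathE ℓ (+ 2 * v) (+ 2 * u))
lemma2p9 ℓ col kR kB (+ u) (+ v) (ℤ.+<+ _) _ (ℤ.+<+ v<u) u<v+ℓ d∞u≡dv+q =
  + v , + u , ℤ.+<+ v<u , u<v+ℓ , refl ,
  +²-cancelˡ (d ℓ col (+ v)) _ _
    (trans (sym (Walk.d∞≡d+δ ℓ col (ℕ.<⇒≤ v<u))) d∞u≡dv+q)
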